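{- Let $n,k,s\geq 2$ be integers with $n\geq sk+1$. Then the fractional chromatic number of the $s$-stable Kneser graph satisfies $\chi^*(KG(n,k)_{s\text{ -stab}})=\frac{n}{k}$.
   Context: Let $[n]=\{1,\dots,n\}$. A subset $S\subseteq[n]$ is $s$-stable if for all distinct $i,j\in S$ we have $s\leq |i-j|\leq n-s$. $[n]^k_s$ denotes the family of $s$-stable $k$-element subsets of $[n]$. The $s$-stable Kneser graph $KG(n,k)_{s\text{ -stab}}$ has vertex set $[n]^k_s$, two vertices being adjacent iff the corresponding $k$-subsets are disjoint. $\chi^*(G)$ denotes the fractional chromatic number of a graph $G$. -}

module Defs where

open import Data.Nat as ℕ using (ℕ; zero; suc; _∸_; ∣_-_∣)
open import Data.Fin using (Fin; toℕ)
open import Data.Fin.Subset using (Subset; _∈_; ∣_∣)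
open import Data.Bool using (Bool; true; false; if_then_else_)
open import Data.Integer using (+_)
open import Data.Rational using (ℚ; _/_; 0ℚ; 1ℚ; _+_; _≤_)
open import Data.List using (List; foldr)
open import Data.List.Relation.Unary.All using (All)
open import Data.Product using (_×_; _,_; proj₁; proj₂; Σ)
open import Relation.Binary.PropositionalEquality using (_≡_; _≢_)
open import Relation.Nullary using (¬_)

-- [n] is represented by Fin n (element i ↦ i+1; differences are unchanged).
-- A subset of [n] is a Subset n.

Stable : (n s : ℕ) → Subset n → Set
Stable n s S = ∀ (i j : Fin n) → i ≢ j → i ∈ S → j ∈ S →
  (s ℕ.≤ ∣ toℕ i - toℕ j ∣) × (∣ toℕ i - toℕ j ∣ ℕ.≤ n ∸ s)

IsVertex : (n k s : ℕ) → Subset n → Set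
IsVertex n k s S = (∣ S ∣ ≡ k) × Stable n s S

Disjoint : {n : ℕ} → Subset n → Subset n → Set
Disjoint {n} S T = ∀ (i : Fin n) → i ∈ S → i ∈ T → ⊥'
  where open import Data.Empty renaming (⊥ to ⊥')

Adj : {n : ℕ} → Subset n → Subset n → Set
Adj = Disjoint

-- An independent set of KG(n,k)_{s-stab}, given by a Boolean indicator on
-- subsets of [n] (only its values on vertices matter).
IsIndependent : (n k s : ℕ) → (Subset n → Bool) → Set
IsIndependent n k s I = ∀ (u v : Subset n) → IsVertex n k s u → IsVertex n k s v →
  I u ≡ true → I v ≡ true → ¬ Adj u v

Weighting : ℕ → Set
Weighting n = List (ℚ × (Subset n → Bool))

totalWeight : {n : ℕ} → Weighting n → ℚ
totalWeight = foldr (λ p acc → proj₁ p + acc) 0ℚ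

weightAt : {n : ℕ} → Weighting n → Subset n → ℚ
weightAt w v = foldr (λ p acc → (if proj₂ p v then proj₁ p else 0ℚ) + acc) 0ℚ w

IsFractionalColouring : (n k s : ℕ) → Weighting n → Set
IsFractionalColouring n k s w =
  All (λ p → (0ℚ ≤ proj₁ p) × IsIndependent n k s (proj₂ p)) w ×
  (∀ (v : Subset n) → IsVertex n k s v → 1ℚ ≤ weightAt w v)

FracChromaticNumberIs : (n k s : ℕ) → ℚ → Set
FracChromaticNumberIs n k s q =
  (Σ (Weighting n) λ w → IsFractionalColouring n k s w × (totalWeight w ≡ q)) ×
  (∀ (w : Weighting n) → IsFractionalColouring n k s w → q ≤ totalWeight w)

-- the rational n / k (k = 0 sent to 0; only used with k ≥ 2)
_/ℕ_ : ℕ → ℕ → ℚ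
n /ℕ zero = 0ℚ
n /ℕ suc k = (+ n) / suc k

-- Upper bound: the n stars {v : x ∈ v}, each of weight 1/k, form a fractional colouring,
-- since every vertex lies in exactly k of them.
-- Lower bound: the n vertices A_j = {⌊(j + m n)/k⌋ : m < k} are s-stable because n ≥ s k, and
-- A_i, A_j meet only if i, j are at distance less than k on the cycle ℤ/n. As in Katona's circle
-- proof of Erdős–Ko–Rado, an independent set therefore contains at most k of the A_j, so summing
-- the covering condition over the A_j gives n ≤ k · (total weight).
module Submission where

open import Function using (_∘_)
open import Data.Empty using (⊥-elim)
open import Data.Product using (Σ; ∃; ∃₂; _×_; _,_; proj₁; proj₂)
open import Data.Sum using (_⊎_; inj₁; inj₂)
open import Relation.Binary.PropositionalEquality
open import Relation.Nullary using (¬_; yes; no)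
open import Defs
open import Data.Nat as ℕ using (ℕ; NonZero; zero; suc)
import Data.Nat.Properties as ℕ

module Arithmetic where

  open import Data.List using ([]; _∷_)
  open import Data.Nat
  open import Data.Nat.Properties
  open import Data.Nat.DivMod
  open import Data.Nat.Tactic.RingSolver using (solve)
  open import Relation.Binary using (tri<; tri≈; tri>)

  congruent-gap : ∀ {n x y p q} → x + p * n ≡ y + q * n → p < q → y + n ≤ x
  congruent-gap {n} {x} {y} {p} eq p<q with m≤n⇒∃[o]m+o≡n p<q
  ... | t , refl = begin
    y + n             ≤⟨ m≤m+n (y + n) (t * n) ⟩
    y + n + t * n     ≡⟨ +-cancelʳ-≡ (p * n) _ x lift ⟩
    x                 ∎
    where
    open ≤-Reasoning
    lift : y + n + t * n + p * n ≡ x + p * n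
    lift = trans rearrange (sym eq)
      where
      rearrange : y + n + t * n + p * n ≡ y + (suc p + t) * n
      rearrange = solve (y ∷ n ∷ t ∷ p ∷ [])

  congruent-close⇒≡ : ∀ {n x y} p q → x + p * n ≡ y + q * n → x < y + n → y < x + n → x ≡ y
  congruent-close⇒≡ {n} {x} {y} p q eq x<y+n y<x+n with <-cmp p q
  ... | tri< p<q _ _  = ⊥-elim (<⇒≱ x<y+n (congruent-gap eq p<q))
  ... | tri≈ _ refl _ = +-cancelʳ-≡ (p * n) x y eq
  ... | tri> _ _ q<p  = ⊥-elim (<⇒≱ y<x+n (congruent-gap (sym eq) q<p))

  module _ (k : ℕ) .{{_ : NonZero k}} where

    *≤⇒≤/ : ∀ c a → c * k ≤ a → c ≤ a / k
    *≤⇒≤/ c a c*k≤a = subst (_≤ a / k) (m*n/n≡m c k) (/-monoˡ-≤ k c*k≤a)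

    /-gap : ∀ {s n x y} → s * k ≤ n → x + n ≤ y → x / k + s ≤ y / k
    /-gap {s} {n} {x} {y} s*k≤n x+n≤y = *≤⇒≤/ (x / k + s) y (begin
      (x / k + s) * k    ≡⟨ *-distribʳ-+ k (x / k) s ⟩
      x / k * k + s * k  ≤⟨ +-mono-≤ (m/n*n≤m x k) s*k≤n ⟩
      x + n              ≤⟨ x+n≤y ⟩
      y                  ∎)
      where open ≤-Reasoning

    /-≡⇒< : ∀ x y → x / k ≡ y / k → x < y + k
    /-≡⇒< x y eq = begin-strict
      x                  ≡⟨ m≡m%n+[m/n]*n x k ⟩
      x % k + x / k * k  <⟨ +-monoˡ-< (x / k * k) (m%n<n x k) ⟩
      k + x / k * k      ≡⟨ cong (λ z → k + z * k) eq ⟩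
      k + y / k * k      ≤⟨ +-monoʳ-≤ k (m/n*n≤m y k) ⟩
      k + y              ≡⟨ +-comm k y ⟩
      y + k              ∎
      where open ≤-Reasoning

    <2k⇒≡%∨≡%+k : ∀ {e} → e < k + k → e ≡ e % k ⊎ e ≡ e % k + k
    <2k⇒≡%∨≡%+k {e} e<2k with e <? k
    ... | yes e<k = inj₁ (sym (m<n⇒m%n≡m e<k))
    ... | no e≮k = inj₂ (begin
      e               ≡⟨ m∸n+n≡m k≤e ⟨
      e ∸ k + k       ≡⟨ cong (_+ k) (m<n⇒m%n≡m e∸k<k) ⟨
      (e ∸ k) % k + k ≡⟨ cong (_+ k) ([m+n]%n≡m%n (e ∸ k) k) ⟨
      (e ∸ k + k) % k + k ≡⟨ cong (λ z → z % k + k) (m∸n+n≡m k≤e) ⟩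
      e % k + k       ∎)
      where
      open ≡-Reasoning
      k≤e = ≮⇒≥ e≮k
      e∸k<k : e ∸ k < k
      e∸k<k = subst (e ∸ k <_) (m+n∸n≡m k k) (∸-monoˡ-< e<2k k≤e)

    %-≡⇒≡∨+k : ∀ {e e′} → e < k + k → e′ < k + k → e % k ≡ e′ % k →
               e ≡ e′ ⊎ e′ ≡ e + k ⊎ e ≡ e′ + k
    %-≡⇒≡∨+k {e} {e′} e<2k e′<2k eq with <2k⇒≡%∨≡%+k e<2k | <2k⇒≡%∨≡%+k e′<2k
    ... | inj₁ p | inj₁ q = inj₁ (trans p (trans eq (sym q)))
    ... | inj₂ p | inj₂ q = inj₁ (trans p (trans (cong (_+ k) eq) (sym q)))
    ... | inj₁ p | inj₂ q = inj₂ (inj₁ (trans q (cong (_+ k) (trans (sym eq) (sym p)))))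
    ... | inj₂ p | inj₁ q = inj₂ (inj₂ (trans p (cong (_+ k) (trans eq (sym q)))))

  gaps⇒stable-distance : ∀ {n s u v} → u + s ≤ v → v + s ≤ u + n →
                         s ≤ ∣ u - v ∣ × ∣ u - v ∣ ≤ n ∸ s
  gaps⇒stable-distance {n} {s} {u} {v} u+s≤v v+s≤u+n
    with m≤n⇒∃[o]m+o≡n (≤-trans (m≤m+n u s) u+s≤v)
  ... | d , refl rewrite ∣m-m+n∣≡n u d =
    +-cancelˡ-≤ u s d u+s≤v ,
    m+n≤o⇒m≤o∸n d (+-cancelˡ-≤ u (d + s) n (subst (_≤ u + n) (+-assoc u d s) v+s≤u+n))

module FiniteSets where

  open import Data.Bool using (Bool; true; false; if_then_else_)
  open import Data.Nat using (_≤_; z≤n; s≤s)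
  open import Data.Fin using (Fin; zero; suc; punchOut)
  open import Data.Fin.Properties using (¬Fin0; 0≢1+n; suc-injective; punchOut-injective; any?)
  open import Data.Fin.Subset using (Subset; _∈_; _∉_; ∣_∣; ⊥; ⁅_⁆; _∪_)
  open import Data.Fin.Subset.Properties
    using (∪-identityˡ; x∈p∪q⁻; x∈⁅y⁆⇒x≡y; ∉⊥; ∣⊥∣≡0; _∈?_)
  open import Data.Vec using ([]; _∷_; here; there; lookup)
  open import Function.Definitions using (Injective)
  open import Relation.Nullary.Decidable using (_×-dec_)

  count : ∀ {m} → (Fin m → Bool) → ℕ
  count {zero}  b = 0
  count {suc m} b = if b zero then suc (count (b ∘ suc)) else count (b ∘ suc)

  count-lookup : ∀ {m} (p : Subset m) → count (lookup p) ≡ ∣ p ∣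
  count-lookup []          = refl
  count-lookup (true ∷ p)  = cong suc (count-lookup p)
  count-lookup (false ∷ p) = count-lookup p

  count≤-injection : ∀ {m k} (b : Fin m → Bool) (g : ∀ x → b x ≡ true → Fin k) →
                     (∀ x y bx by → g x bx ≡ g y by → x ≡ y) → count b ≤ k
  count≤-injection {zero} b g g-inj = z≤n
  count≤-injection {suc m} {k} b g g-inj with b zero in b₀ | k
  ... | false | _ = count≤-injection (b ∘ suc) (g ∘ suc)
                      (λ x y bx by → suc-injective ∘ g-inj (suc x) (suc y) bx by)
  ... | true | zero = ⊥-elim (¬Fin0 (g zero b₀))
  ... | true | suc k′ = s≤s (count≤-injection (b ∘ suc) g′ g′-inj)
    where
    g₀≢g : ∀ x bx → g zero b₀ ≢ g (suc x) bx
    g₀≢g x bx = 0≢1+n ∘ g-inj zero (suc x) b₀ bx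
    g′ : ∀ x → b (suc x) ≡ true → Fin k′
    g′ x bx = punchOut (g₀≢g x bx)
    g′-inj : ∀ x y bx by → g′ x bx ≡ g′ y by → x ≡ y
    g′-inj x y bx by = suc-injective ∘ g-inj (suc x) (suc y) bx by ∘ punchOut-injective (g₀≢g x bx) (g₀≢g y by)

  ∣⁅x⁆∪p∣≡1+∣p∣ : ∀ {n} (x : Fin n) (p : Subset n) → x ∉ p → ∣ ⁅ x ⁆ ∪ p ∣ ≡ suc ∣ p ∣
  ∣⁅x⁆∪p∣≡1+∣p∣ zero    (true ∷ p)  x∉p = ⊥-elim (x∉p here)
  ∣⁅x⁆∪p∣≡1+∣p∣ zero    (false ∷ p) _   = cong (suc ∘ ∣_∣) (∪-identityˡ p)
  ∣⁅x⁆∪p∣≡1+∣p∣ (suc x) (true ∷ p)  x∉p = cong suc (∣⁅x⁆∪p∣≡1+∣p∣ x p (x∉p ∘ there))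
  ∣⁅x⁆∪p∣≡1+∣p∣ (suc x) (false ∷ p) x∉p = ∣⁅x⁆∪p∣≡1+∣p∣ x p (x∉p ∘ there)

  image : ∀ {k n} → (Fin k → Fin n) → Subset n
  image {zero}  f = ⊥
  image {suc k} f = ⁅ f zero ⁆ ∪ image (f ∘ suc)

  ∈-image⁻ : ∀ {k n} (f : Fin k → Fin n) {x} → x ∈ image f → ∃ λ i → x ≡ f i
  ∈-image⁻ {zero}  f x∈ = ⊥-elim (∉⊥ x∈)
  ∈-image⁻ {suc k} f x∈ with x∈p∪q⁻ ⁅ f zero ⁆ (image (f ∘ suc)) x∈
  ... | inj₁ x∈⁅f₀⁆ = zero , x∈⁅y⁆⇒x≡y (f zero) x∈⁅f₀⁆
  ... | inj₂ x∈rest with ∈-image⁻ (f ∘ suc) x∈rest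
  ...   | i , x≡fi = suc i , x≡fi

  ∣image∣ : ∀ {k n} (f : Fin k → Fin n) → Injective _≡_ _≡_ f → ∣ image f ∣ ≡ k
  ∣image∣ {zero}  {n} f f-inj = ∣⊥∣≡0 n
  ∣image∣ {suc k} f f-inj = begin
    ∣ ⁅ f zero ⁆ ∪ image (f ∘ suc) ∣  ≡⟨ ∣⁅x⁆∪p∣≡1+∣p∣ (f zero) (image (f ∘ suc)) f₀∉ ⟩
    suc ∣ image (f ∘ suc) ∣            ≡⟨ cong suc (∣image∣ (f ∘ suc) (suc-injective ∘ f-inj)) ⟩
    suc k                              ∎
    where
    open ≡-Reasoning
    f₀∉ : f zero ∉ image (f ∘ suc)
    f₀∉ f₀∈ with ∈-image⁻ (f ∘ suc) f₀∈
    ... | i , f₀≡fi = 0≢1+n (f-inj f₀≡fi)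

  ¬Disjoint⇒common : ∀ {n} {p q : Subset n} → ¬ Disjoint p q → ∃ λ x → x ∈ p × x ∈ q
  ¬Disjoint⇒common {p = p} {q} ¬disjoint with any? (λ x → x ∈? p ×-dec x ∈? q)
  ... | yes common = common
  ... | no ¬common = ⊥-elim (¬disjoint λ x x∈p x∈q → ¬common (x , x∈p , x∈q))

module CircleBound (n k : ℕ) .{{_ : NonZero n}} .{{_ : NonZero k}} where

  open import Data.Bool using (Bool; true)
  open import Data.Bool.Properties using () renaming (_≟_ to _≟ᵇ_)
  open import Data.List using ([]; _∷_)
  open import Data.Nat
  open import Data.Nat.Properties
  open import Data.Nat.DivMod
  open import Data.Nat.Tactic.RingSolver using (solve)
  open import Data.Fin using (Fin; toℕ)
  open import Data.Fin.Properties using (toℕ-injective; toℕ<n; fromℕ<-injective; any?)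
  open import Algebra.Properties.CommutativeSemigroup +-commutativeSemigroup using (xy∙z≈xz∙y)
  open Arithmetic
  open FiniteSets using (count; count≤-injection)

  -- i and j are at distance less than k on the cycle of length n
  Close : ℕ → ℕ → Set
  Close i j = ∃₂ λ p q → i + p * n < j + q * n + k × j + q * n < i + p * n + k

  offset : ℕ → ℕ → ℕ
  offset i j = (j + k + (n ∸ i)) % n

  -- j + k ≡ i + e modulo n
  record Offset (i e j : ℕ) : Set where
    constructor offsetBy
    field
      turnsᵢ turnsⱼ : ℕ
      lifts≡ : e + (i + turnsᵢ * n) ≡ j + turnsⱼ * n + k

  same-offset⇒≡ : ∀ {e i x y} → x < n → y < n → Offset i e x → Offset i e y → x ≡ y
  same-offset⇒≡ {e} {i} {x} {y} x<n y<n (offsetBy p q eqx) (offsetBy p′ q′ eqy) =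
    congruent-close⇒≡ (q + p′) (q′ + p) (+-cancelʳ-≡ k _ _ lifts)
      (<-≤-trans x<n (m≤n+m n y)) (<-≤-trans y<n (m≤n+m n x))
    where
    open ≡-Reasoning
    lifts : x + (q + p′) * n + k ≡ y + (q′ + p) * n + k
    lifts = begin
      x + (q + p′) * n + k          ≡⟨ solve (x ∷ q ∷ p′ ∷ n ∷ k ∷ []) ⟩
      (x + q * n + k) + p′ * n      ≡⟨ cong (_+ p′ * n) eqx ⟨
      (e + (i + p * n)) + p′ * n    ≡⟨ solve (e ∷ i ∷ p ∷ n ∷ p′ ∷ []) ⟩
      (e + (i + p′ * n)) + p * n    ≡⟨ cong (_+ p * n) eqy ⟩
      (y + q′ * n + k) + p * n      ≡⟨ solve (y ∷ q′ ∷ n ∷ k ∷ p ∷ []) ⟩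
      y + (q′ + p) * n + k          ∎

  offset-unique : ∀ {i e j} → i < n → e < n → Offset i e j → offset i j ≡ e
  offset-unique {i} {e} {j} i<n e<n (offsetBy p q e+i≡j+k) = begin
    M % n                ≡⟨ [m+kn]%n≡m%n M q n ⟨
    (M + q * n) % n      ≡⟨ cong (_% n) lift ⟨
    (e + suc p * n) % n  ≡⟨ [m+kn]%n≡m%n e (suc p) n ⟩
    e % n                ≡⟨ m<n⇒m%n≡m e<n ⟩
    e                    ∎
    where
    open ≡-Reasoning
    M = j + k + (n ∸ i)
    M+i≡j+k+n : M + i ≡ j + k + n
    M+i≡j+k+n = trans (+-assoc (j + k) (n ∸ i) i) (cong (j + k +_) (m∸n+n≡m (<⇒≤ i<n)))
    lift : e + suc p * n ≡ M + q * n
    lift = +-cancelʳ-≡ i _ _ (begin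
      e + suc p * n + i      ≡⟨ solve (e ∷ p ∷ n ∷ i ∷ []) ⟩
      e + (i + p * n) + n    ≡⟨ cong (_+ n) e+i≡j+k ⟩
      j + q * n + k + n      ≡⟨ solve (j ∷ q ∷ n ∷ k ∷ []) ⟩
      j + k + n + q * n      ≡⟨ cong (_+ q * n) M+i≡j+k+n ⟨
      M + i + q * n          ≡⟨ xy∙z≈xz∙y M i (q * n) ⟩
      M + q * n + i          ∎)

  Close⇒Offset : ∀ {i j} → Close i j → ∃ λ e → Offset i e j × e < k + k
  Close⇒Offset {i} {j} (p , q , lt₁ , lt₂) with m≤n⇒∃[o]m+o≡n (<⇒≤ lt₁)
  ... | e , i+e≡j+k = e , offsetBy p q e+i≡j+k , e<2k
    where
    e+i≡j+k : e + (i + p * n) ≡ j + q * n + k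
    e+i≡j+k = trans (+-comm e (i + p * n)) i+e≡j+k
    e<2k : e < k + k
    e<2k = +-cancelʳ-< (i + p * n) e (k + k) (begin-strict
      e + (i + p * n)      ≡⟨ e+i≡j+k ⟩
      j + q * n + k        <⟨ +-monoˡ-< k lt₂ ⟩
      i + p * n + k + k    ≡⟨ solve (i ∷ p ∷ n ∷ k ∷ []) ⟩
      k + k + (i + p * n)  ∎)
      where open ≤-Reasoning

  module _ (k+k≤n : k + k ≤ n) where

    offset-spec : ∀ {i j} → i < n → Close i j → Offset i (offset i j) j × offset i j < k + k
    offset-spec i<n close with Close⇒Offset close
    ... | e , off , e<2k rewrite offset-unique i<n (<-≤-trans e<2k k+k≤n) off = off , e<2k

    -- Offsets differing by k put x and y at distance exactly k modulo n.
    shifted-offset⇒¬Close : ∀ {e i x y} → Offset i e x → Offset i (e + k) y → ¬ Close x y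
    shifted-offset⇒¬Close {e} {i} {x} {y} (offsetBy p q eqx) (offsetBy p′ q′ eqy) (a , b , lt₁ , lt₂) =
      <-irrefl (sym X≡Y) lt₂
      where
      eqy′ : e + (i + p′ * n) ≡ y + q′ * n
      eqy′ = +-cancelʳ-≡ k _ _ (trans (xy∙z≈xz∙y e (i + p′ * n) k) eqy)
      lifts : x + a * n + k + (q + p′ + b) * n ≡ y + b * n + (q′ + p + a) * n
      lifts = begin
        x + a * n + k + (q + p′ + b) * n                     ≡⟨ solve (x ∷ a ∷ n ∷ k ∷ q ∷ p′ ∷ b ∷ []) ⟩
        (x + q * n + k) + p′ * n + (a * n + b * n)           ≡⟨ cong (λ z → z + p′ * n + (a * n + b * n)) eqx ⟨
        (e + (i + p * n)) + p′ * n + (a * n + b * n)         ≡⟨ solve (e ∷ i ∷ p ∷ n ∷ p′ ∷ a ∷ b ∷ []) ⟩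
        (e + (i + p′ * n)) + p * n + (a * n + b * n)         ≡⟨ cong (λ z → z + p * n + (a * n + b * n)) eqy′ ⟩
        (y + q′ * n) + p * n + (a * n + b * n)               ≡⟨ solve (y ∷ q′ ∷ n ∷ p ∷ a ∷ b ∷ []) ⟩
        y + b * n + (q′ + p + a) * n                         ∎
        where open ≡-Reasoning
      X<Y+n : x + a * n + k < y + b * n + n
      X<Y+n = begin-strict
        x + a * n + k        <⟨ +-monoˡ-< k lt₁ ⟩
        y + b * n + k + k    ≡⟨ +-assoc (y + b * n) k k ⟩
        y + b * n + (k + k)  ≤⟨ +-monoʳ-≤ (y + b * n) k+k≤n ⟩
        y + b * n + n        ∎
        where open ≤-Reasoning
      X≡Y : x + a * n + k ≡ y + b * n
      X≡Y = congruent-close⇒≡ (q + p′ + b) (q′ + p + a) lifts X<Y+n (<-≤-trans lt₂ (m≤m+n _ n))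

    -- Katona's circle argument: fixing i₀ in the family, j ↦ offset i₀ j mod k is injective on it.
    circle-bound : (b : Fin n → Bool) → (∀ i j → b i ≡ true → b j ≡ true → Close (toℕ i) (toℕ j)) →
                   count b ≤ k
    circle-bound b close with any? (λ i → b i ≟ᵇ true)
    ... | no ∄i = count≤-injection b (λ i bi → ⊥-elim (∄i (i , bi))) (λ i _ bi → ⊥-elim (∄i (i , bi)))
    ... | yes (i₀ , bi₀) = count≤-injection b (λ j _ → offset (toℕ i₀) (toℕ j) mod k) injective
      where
      injective : ∀ x y bx by → offset (toℕ i₀) (toℕ x) mod k ≡ offset (toℕ i₀) (toℕ y) mod k → x ≡ y
      injective x y bx by eq
        with offset-spec (toℕ<n i₀) (close i₀ x bi₀ bx) | offset-spec (toℕ<n i₀) (close i₀ y bi₀ by)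
      ... | off-x , ex<2k | off-y , ey<2k
        with %-≡⇒≡∨+k k ex<2k ey<2k (fromℕ<-injective _ _ _ _ eq)
      ...   | inj₁ ex≡ey = toℕ-injective
                (same-offset⇒≡ (toℕ<n x) (toℕ<n y) off-x (subst (λ e → Offset _ e _) (sym ex≡ey) off-y))
      ...   | inj₂ (inj₁ ey≡ex+k) =
                ⊥-elim (shifted-offset⇒¬Close off-x (subst (λ e → Offset _ e _) ey≡ex+k off-y) (close x y bx by))
      ...   | inj₂ (inj₂ ex≡ey+k) =
                ⊥-elim (shifted-offset⇒¬Close off-y (subst (λ e → Offset _ e _) ex≡ey+k off-x) (close y x by bx))

module SpreadSets (n k : ℕ) .{{_ : NonZero n}} .{{_ : NonZero k}} where

  open import Data.Bool using (true)
  open import Data.Nat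
  open import Data.Nat.Properties
  open import Data.Nat.DivMod
  open import Data.Nat.Divisibility using (n∣m*n)
  open import Data.Fin using (Fin; toℕ; fromℕ<)
  open import Data.Fin.Properties using (toℕ<n; toℕ-fromℕ<; toℕ-injective)
  open import Data.Fin.Subset using (Subset; _∈_)
  open import Function.Definitions using (Injective)
  open import Relation.Binary using (tri<; tri≈; tri>)
  open Arithmetic
  open FiniteSets using (count; image; ∈-image⁻; ∣image∣; ¬Disjoint⇒common)
  open CircleBound n k using (Close; circle-bound)

  spread : ℕ → ℕ → ℕ
  spread j m = (j + m * n) / k

  spread<n : ∀ {j m} → j < n → m < k → spread j m < n
  spread<n {j} {m} j<n m<k = m<n*o⇒m/o<n (begin-strict
    j + m * n  <⟨ +-monoˡ-< (m * n) j<n ⟩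
    n + m * n  ≤⟨ *-monoˡ-≤ n m<k ⟩
    k * n      ≡⟨ *-comm k n ⟩
    n * k      ∎)
    where open ≤-Reasoning

  module _ {s : ℕ} (s*k≤n : s * k ≤ n) where

    spread-gap : ∀ j {a b} → a < b → spread j a + s ≤ spread j b
    spread-gap j {a} {b} a<b = /-gap k s*k≤n (begin
      j + a * n + n  ≡⟨ +-assoc j (a * n) n ⟩
      j + (a * n + n) ≡⟨ cong (j +_) (+-comm (a * n) n) ⟩
      j + suc a * n  ≤⟨ +-monoʳ-≤ j (*-monoˡ-≤ n a<b) ⟩
      j + b * n      ∎)
      where open ≤-Reasoning

    spread-wrap : ∀ j a {b} → b < k → spread j b + s ≤ spread j a + n
    spread-wrap j a {b} b<k = begin
      spread j b + s               ≤⟨ /-gap k s*k≤n bound ⟩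
      (j + a * n + n * k) / k      ≡⟨ +-distrib-/-∣ʳ (j + a * n) (n∣m*n n) ⟩
      spread j a + n * k / k       ≡⟨ cong (spread j a +_) (m*n/n≡m n k) ⟩
      spread j a + n               ∎
      where
      open ≤-Reasoning
      bound : j + b * n + n ≤ j + a * n + n * k
      bound = begin
        j + b * n + n        ≡⟨ +-assoc j (b * n) n ⟩
        j + (b * n + n)      ≡⟨ cong (j +_) (+-comm (b * n) n) ⟩
        j + suc b * n        ≤⟨ +-monoʳ-≤ j (*-monoˡ-≤ n b<k) ⟩
        j + k * n            ≡⟨ cong (j +_) (*-comm k n) ⟩
        j + n * k            ≤⟨ +-monoˡ-≤ (n * k) (m≤m+n j (a * n)) ⟩
        j + a * n + n * k    ∎

  spreadPoint : Fin n → Fin k → Fin n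
  spreadPoint j m = fromℕ< (spread<n (toℕ<n j) (toℕ<n m))

  toℕ-spreadPoint : ∀ j m → toℕ (spreadPoint j m) ≡ spread (toℕ j) (toℕ m)
  toℕ-spreadPoint j m = toℕ-fromℕ< _

  spreadSet : Fin n → Subset n
  spreadSet j = image (spreadPoint j)

  ∈-spreadSet⁻ : ∀ {j x} → x ∈ spreadSet j → ∃ λ m → toℕ x ≡ spread (toℕ j) (toℕ m)
  ∈-spreadSet⁻ {j} x∈ with ∈-image⁻ (spreadPoint j) x∈
  ... | m , refl = m , toℕ-spreadPoint j m

  spreadSets-meet⇒Close : ∀ {i j x} → x ∈ spreadSet i → x ∈ spreadSet j → Close (toℕ i) (toℕ j)
  spreadSets-meet⇒Close x∈i x∈j with ∈-spreadSet⁻ x∈i | ∈-spreadSet⁻ x∈j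
  ... | a , x≡a | b , x≡b =
    toℕ a , toℕ b , /-≡⇒< k _ _ (trans (sym x≡a) x≡b) , /-≡⇒< k _ _ (trans (sym x≡b) x≡a)

  module _ {s : ℕ} (1≤s : 1 ≤ s) (s*k≤n : s * k ≤ n) where

    spread-stable : ∀ j {a b} → a < b → b < k →
                    s ≤ ∣ spread j a - spread j b ∣ × ∣ spread j a - spread j b ∣ ≤ n ∸ s
    spread-stable j {a} a<b b<k = gaps⇒stable-distance (spread-gap s*k≤n j a<b) (spread-wrap s*k≤n j a b<k)

    spread-< : ∀ j {a b} → a < b → spread j a < spread j b
    spread-< j {a} a<b = <-≤-trans (m<m+n (spread j a) 1≤s) (spread-gap s*k≤n j a<b)

    spread-injective : ∀ j {a b} → spread j a ≡ spread j b → a ≡ b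
    spread-injective j {a} {b} eq with <-cmp a b
    ... | tri< a<b _ _ = ⊥-elim (<-irrefl eq (spread-< j a<b))
    ... | tri≈ _ a≡b _ = a≡b
    ... | tri> _ _ b<a = ⊥-elim (<-irrefl (sym eq) (spread-< j b<a))

    spreadPoint-injective : ∀ j → Injective _≡_ _≡_ (spreadPoint j)
    spreadPoint-injective j {a} {b} eq = toℕ-injective (spread-injective (toℕ j)
      (trans (sym (toℕ-spreadPoint j a)) (trans (cong toℕ eq) (toℕ-spreadPoint j b))))

    spreadSet-stable : ∀ j → Stable n s (spreadSet j)
    spreadSet-stable j x y x≢y x∈ y∈ with ∈-spreadSet⁻ x∈ | ∈-spreadSet⁻ y∈
    ... | a , x≡ | b , y≡ rewrite x≡ | y≡ with <-cmp (toℕ a) (toℕ b)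
    ...   | tri< a<b _ _ = spread-stable (toℕ j) a<b (toℕ<n b)
    ...   | tri≈ _ a≡b _ = ⊥-elim (x≢y (toℕ-injective (trans x≡ (trans (cong (spread (toℕ j)) a≡b) (sym y≡)))))
    ...   | tri> _ _ b<a rewrite ∣-∣-comm (spread (toℕ j) (toℕ a)) (spread (toℕ j) (toℕ b)) =
              spread-stable (toℕ j) b<a (toℕ<n a)

    spreadSet-isVertex : ∀ j → IsVertex n k s (spreadSet j)
    spreadSet-isVertex j = ∣image∣ (spreadPoint j) (spreadPoint-injective j) , spreadSet-stable j

    count-spreadSets≤k : k + k ≤ n → ∀ I → IsIndependent n k s I → count (λ j → I (spreadSet j)) ≤ k
    count-spreadSets≤k k+k≤n I I-indep = circle-bound k+k≤n (λ j → I (spreadSet j)) meet⇒Close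
      where
      meet⇒Close : ∀ i j → I (spreadSet i) ≡ true → I (spreadSet j) ≡ true → Close (toℕ i) (toℕ j)
      meet⇒Close i j Ii Ij with ¬Disjoint⇒common
        (I-indep _ _ (spreadSet-isVertex i) (spreadSet-isVertex j) Ii Ij)
      ... | x , x∈i , x∈j = spreadSets-meet⇒Close x∈i x∈j

module RationalCasts where

  open import Data.Integer as ℤ using (+_)
  import Data.Integer.Properties as ℤ
  open import Data.Rational
  open import Data.Rational.Properties
  open import Data.Rational.Unnormalised as ℚᵘ using (mkℚᵘ; *≡*)
  import Data.Rational.Unnormalised.Properties as ℚᵘ

  ι : ℕ → ℚ
  ι m = m /ℕ 1

  private
    toℚᵘ-/ℕ : ∀ a d → toℚᵘ (a /ℕ suc d) ℚᵘ.≃ mkℚᵘ (+ a) d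
    toℚᵘ-/ℕ a d = toℚᵘ-fromℚᵘ (mkℚᵘ (+ a) d)

  /ℕ-+ : ∀ a b d → a /ℕ suc d + b /ℕ suc d ≡ (a ℕ.+ b) /ℕ suc d
  /ℕ-+ a b d = toℚᵘ-injective (ℚᵘ.≃-trans (toℚᵘ-homo-+ (a /ℕ suc d) (b /ℕ suc d))
    (ℚᵘ.≃-trans (ℚᵘ.+-cong (toℚᵘ-/ℕ a d) (toℚᵘ-/ℕ b d))
    (ℚᵘ.≃-trans (*≡* cross) (ℚᵘ.≃-sym (toℚᵘ-/ℕ (a ℕ.+ b) d)))))
    where
    cross : (+ a ℤ.* + suc d ℤ.+ + b ℤ.* + suc d) ℤ.* + suc d ≡ + (a ℕ.+ b) ℤ.* (+ suc d ℤ.* + suc d)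
    cross = begin
      (+ a ℤ.* + suc d ℤ.+ + b ℤ.* + suc d) ℤ.* + suc d  ≡⟨ cong (ℤ._* + suc d) (ℤ.*-distribʳ-+ (+ suc d) (+ a) (+ b)) ⟨
      (+ a ℤ.+ + b) ℤ.* + suc d ℤ.* + suc d              ≡⟨ ℤ.*-assoc (+ a ℤ.+ + b) (+ suc d) (+ suc d) ⟩
      (+ a ℤ.+ + b) ℤ.* (+ suc d ℤ.* + suc d)            ≡⟨ cong (ℤ._* (+ suc d ℤ.* + suc d)) (ℤ.pos-+ a b) ⟨
      + (a ℕ.+ b) ℤ.* (+ suc d ℤ.* + suc d)              ∎
      where open ≡-Reasoning

  ι-*-1/ℕ : ∀ a d → ι a * 1 /ℕ suc d ≡ a /ℕ suc d
  ι-*-1/ℕ a d = toℚᵘ-injective (ℚᵘ.≃-trans (toℚᵘ-homo-* (ι a) (1 /ℕ suc d))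
    (ℚᵘ.≃-trans (ℚᵘ.*-cong (toℚᵘ-/ℕ a 0) (toℚᵘ-/ℕ 1 d))
    (ℚᵘ.≃-trans (*≡* cross) (ℚᵘ.≃-sym (toℚᵘ-/ℕ a d)))))
    where
    cross : (+ a ℤ.* + 1) ℤ.* + suc d ≡ + a ℤ.* (+ 1 ℤ.* + suc d)
    cross = ℤ.*-assoc (+ a) (+ 1) (+ suc d)

  /ℕ-self : ∀ d → suc d /ℕ suc d ≡ 1ℚ
  /ℕ-self d = toℚᵘ-injective (ℚᵘ.≃-trans (toℚᵘ-/ℕ (suc d) d)
    (ℚᵘ.≃-trans (*≡* (ℤ.*-comm (+ suc d) (+ 1))) (ℚᵘ.≃-sym (toℚᵘ-/ℕ 1 0))))

  /ℕ-nonNeg : ∀ a d → 0ℚ ≤ a /ℕ suc d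
  /ℕ-nonNeg a d = nonNegative⁻¹ _ {{normalize-nonNeg a (suc d)}}

  ι-suc : ∀ m → ι (suc m) ≡ 1ℚ + ι m
  ι-suc m = sym (/ℕ-+ 1 m 0)

  ι-mono-≤ : ∀ {a b} → a ℕ.≤ b → ι a ≤ ι b
  ι-mono-≤ {a} a≤b with ℕ.m≤n⇒∃[o]m+o≡n a≤b
  ... | c , refl = begin
     ι a           ≡⟨ +-identityʳ (ι a) ⟨
     ι a + 0ℚ      ≤⟨ +-monoʳ-≤ (ι a) (/ℕ-nonNeg c 0) ⟩
     ι a + ι c     ≡⟨ /ℕ-+ a c 0 ⟩
     ι (a ℕ.+ c)   ∎
    where open ≤-Reasoning

module FractionalBounds (n d s : ℕ) where

  open import Data.Bool using (Bool; true; false; if_then_else_)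
  open import Data.Rational
  open import Data.Rational.Properties
  open import Data.Fin using (Fin; zero; suc)
  open import Data.Fin.Subset using (Subset)
  open import Data.Vec using (lookup)
  open import Data.Vec.Properties using (lookup⇒[]=)
  open import Data.List using ([]; _∷_; tabulate)
  open import Data.List.Relation.Unary.All using (All; []; _∷_)
  open import Data.List.Relation.Unary.All.Properties using (tabulate⁺)
  open import Algebra.Properties.CommutativeMonoid.Sum +-0-commutativeMonoid using (sum; ∑-distrib-+; sum-replicate-zero)
  open FiniteSets using (count; count-lookup)
  open RationalCasts

  k : ℕ
  k = suc d

  IndependentWeights : Weighting n → Set
  IndependentWeights = All (λ p → (0ℚ ≤ proj₁ p) × IsIndependent n k s (proj₂ p))

  module _ (r : ℚ) where

    ι-suc-* : ∀ m → ι (suc m) * r ≡ r + ι m * r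
    ι-suc-* m = begin
      ι (suc m) * r        ≡⟨ cong (_* r) (ι-suc m) ⟩
      (1ℚ + ι m) * r       ≡⟨ *-distribʳ-+ r 1ℚ (ι m) ⟩
      1ℚ * r + ι m * r     ≡⟨ cong (_+ ι m * r) (*-identityˡ r) ⟩
      r + ι m * r          ∎
      where open ≡-Reasoning

    totalWeight-tabulate : ∀ {m} (H : Fin m → Subset n → Bool) →
                           totalWeight (tabulate (λ x → r , H x)) ≡ ι m * r
    totalWeight-tabulate {zero} H = sym (*-zeroˡ r)
    totalWeight-tabulate {suc m} H = trans (cong (r +_) (totalWeight-tabulate (H ∘ suc))) (sym (ι-suc-* m))

    ∑-indicator : ∀ {m} (b : Fin m → Bool) → sum (λ x → if b x then r else 0ℚ) ≡ ι (count b) * r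
    ∑-indicator {zero} b = sym (*-zeroˡ r)
    ∑-indicator {suc m} b with b zero
    ... | true = trans (cong (r +_) (∑-indicator (b ∘ suc))) (sym (ι-suc-* (count (b ∘ suc))))
    ... | false = trans (+-identityˡ _) (∑-indicator (b ∘ suc))

    weightAt-tabulate : ∀ {m} (H : Fin m → Subset n → Bool) v →
                        weightAt (tabulate (λ x → r , H x)) v ≡ sum (λ x → if H x v then r else 0ℚ)
    weightAt-tabulate {zero} H v = refl
    weightAt-tabulate {suc m} H v = cong ((if H zero v then r else 0ℚ) +_) (weightAt-tabulate (H ∘ suc) v)

  ι≤∑ : ∀ {m} (f : Fin m → ℚ) → (∀ x → 1ℚ ≤ f x) → ι m ≤ sum f
  ι≤∑ {zero} f 1≤f = ≤-refl
  ι≤∑ {suc m} f 1≤f = begin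
    ι (suc m)                  ≡⟨ ι-suc m ⟩
    1ℚ + ι m                   ≤⟨ +-mono-≤ (1≤f zero) (ι≤∑ (f ∘ suc) (1≤f ∘ suc)) ⟩
    f zero + sum (f ∘ suc)     ∎
    where open ≤-Reasoning

  ι-k*1/k : ι k * 1 /ℕ k ≡ 1ℚ
  ι-k*1/k = trans (ι-*-1/ℕ k d) (/ℕ-self d)

  star : Fin n → Subset n → Bool
  star x v = lookup v x

  star-independent : ∀ x → IsIndependent n k s (star x)
  star-independent x u v _ _ x∈u x∈v disjoint = disjoint x (lookup⇒[]= x u x∈u) (lookup⇒[]= x v x∈v)

  starColouring : Σ (Weighting n) λ w → IsFractionalColouring n k s w × totalWeight w ≡ n /ℕ k
  starColouring = w , (tabulate⁺ (λ x → /ℕ-nonNeg 1 d , star-independent x) , covers) , total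
    where
    w = tabulate (λ x → 1 /ℕ k , star x)
    covers : ∀ v → IsVertex n k s v → 1ℚ ≤ weightAt w v
    covers v (∣v∣≡k , _) = ≤-reflexive (sym (begin
      weightAt w v                                 ≡⟨ weightAt-tabulate (1 /ℕ k) star v ⟩
      sum (λ x → if star x v then 1 /ℕ k else 0ℚ)   ≡⟨ ∑-indicator (1 /ℕ k) (λ x → star x v) ⟩
      ι (count (lookup v)) * 1 /ℕ k                ≡⟨ cong (λ c → ι c * 1 /ℕ k) (trans (count-lookup v) ∣v∣≡k) ⟩
      ι k * 1 /ℕ k                                 ≡⟨ ι-k*1/k ⟩
      1ℚ                                           ∎))
      where open ≡-Reasoning
    total : totalWeight w ≡ n /ℕ k
    total = trans (totalWeight-tabulate (1 /ℕ k) star) (ι-*-1/ℕ n d)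

  module _ (A : Fin n → Subset n) (A-vertex : ∀ j → IsVertex n k s (A j))
           (A-sparse : ∀ I → IsIndependent n k s I → count (λ j → I (A j)) ℕ.≤ k) where

    ∑-weightAt≤ : ∀ w → IndependentWeights w → sum (λ j → weightAt w (A j)) ≤ ι k * totalWeight w
    ∑-weightAt≤ [] [] = ≤-reflexive (trans (sum-replicate-zero n) (sym (*-zeroʳ (ι k))))
    ∑-weightAt≤ ((r , I) ∷ w) ((0≤r , I-indep) ∷ w-ok) = begin
      sum (λ j → (if I (A j) then r else 0ℚ) + weightAt w (A j))
        ≡⟨ ∑-distrib-+ (λ j → if I (A j) then r else 0ℚ) (λ j → weightAt w (A j)) ⟩
      sum (λ j → if I (A j) then r else 0ℚ) + sum (λ j → weightAt w (A j))
        ≡⟨ cong (_+ sum (λ j → weightAt w (A j))) (∑-indicator r (λ j → I (A j))) ⟩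
      ι (count (λ j → I (A j))) * r + sum (λ j → weightAt w (A j))
        ≤⟨ +-mono-≤ (*-monoʳ-≤-nonNeg r {{nonNegative 0≤r}} (ι-mono-≤ (A-sparse I I-indep)))
                    (∑-weightAt≤ w w-ok) ⟩
      ι k * r + ι k * totalWeight w
        ≡⟨ *-distribˡ-+ (ι k) r (totalWeight w) ⟨
      ι k * (r + totalWeight w) ∎
      where open ≤-Reasoning

    fractional-lower-bound : ∀ w → IsFractionalColouring n k s w → n /ℕ k ≤ totalWeight w
    fractional-lower-bound w (w-ok , covers) = begin
      n /ℕ k                       ≡⟨ ι-*-1/ℕ n d ⟨
      ι n * 1 /ℕ k                 ≤⟨ *-monoʳ-≤-nonNeg (1 /ℕ k) {{nonNegative (/ℕ-nonNeg 1 d)}} n≤k*T ⟩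
      ι k * T * 1 /ℕ k             ≡⟨ cong (_* 1 /ℕ k) (*-comm (ι k) T) ⟩
      T * ι k * 1 /ℕ k             ≡⟨ *-assoc T (ι k) (1 /ℕ k) ⟩
      T * (ι k * 1 /ℕ k)           ≡⟨ cong (T *_) ι-k*1/k ⟩
      T * 1ℚ                       ≡⟨ *-identityʳ T ⟩
      T                            ∎
      where
      open ≤-Reasoning
      T = totalWeight w
      n≤k*T : ι n ≤ ι k * T
      n≤k*T = ≤-trans (ι≤∑ _ (λ j → covers (A j) (A-vertex j))) (∑-weightAt≤ w w-ok)

open import Data.Nat using (_≤_; _*_; _+_; s≤s; z≤n)
open import Data.Nat.Properties using (≤-trans; ≤-reflexive; m≤m+n; +-identityʳ; *-monoˡ-≤)
open SpreadSets using (spreadSet; spreadSet-isVertex; count-spreadSets≤k)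
open FractionalBounds using (starColouring; fractional-lower-bound)

proposition1 : ∀ (n k s : ℕ) → 2 ≤ n → 2 ≤ k → 2 ≤ s → s * k + 1 ≤ n →
    FracChromaticNumberIs n k s (n /ℕ k)
proposition1 n@(suc _) k@(suc d) s (s≤s _) (s≤s _) 2≤s s*k+1≤n =
  starColouring n d s ,
  fractional-lower-bound n d s (spreadSet n k) (spreadSet-isVertex n k 1≤s s*k≤n)
    (count-spreadSets≤k n k 1≤s s*k≤n k+k≤n)
  where
  s*k≤n : s * k ≤ n
  s*k≤n = ≤-trans (m≤m+n (s * k) 1) s*k+1≤n
  1≤s : 1 ≤ s
  1≤s = ≤-trans (s≤s z≤n) 2≤s
  k+k≤n : k + k ≤ n
  k+k≤n = ≤-trans (≤-reflexive (cong (k +_) (sym (+-identityʳ k)))) (≤-trans (*-monoˡ-≤ k 2≤s) s*k≤n)
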